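{- Let $m$ be a positive integer dividing $n$, and let $X_{n/m}$ be the set of partitions of $\{1,\dots,n\}$ into $n/m$ (unordered) cells each of size $m$. If $\pi\in S_n$ has $c$ cycles, then the number of partitions in $X_{n/m}$ preserved by $\pi$ is at most $m^{O(n)} c^{(1-1/m)c}$, where the implied constant is absolute.
   Context: $c$ counts all cycles of $\pi$, including fixed points. -}

module Defs where

open import Data.Nat using (ℕ; zero; suc; _≤_; _≤?_)
open import Data.Bool using (Bool; true)
open import Data.Fin using (Fin; toℕ)
open import Data.Fin.Permutation using (Permutation′; _⟨$⟩ʳ_)
open import Data.List using (List; length; filter; allFin; upTo)
open import Data.List.Relation.Unary.All using (All; all?)
open import Data.Vec using (Vec; lookup)
open import Data.Product using (_×_)
open import Relation.Binary.PropositionalEquality using (_≡_)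
open import Relation.Nullary.Decidable using (does)
open import Data.Bool using (T)
open import Relation.Nullary.Decidable using (Dec)
open import Data.Bool.Properties using (T?)

iter : ∀ {n} → Permutation′ n → ℕ → Fin n → Fin n
iter π zero    i = i
iter π (suc k) i = π ⟨$⟩ʳ (iter π k i)

-- i is the least element of its cycle (orbit) under π.
-- Every orbit point is π^k i for some k < n, so checking k < n suffices.
isCycleMin : ∀ {n} → Permutation′ n → Fin n → Set
isCycleMin {n} π i = All (λ k → toℕ i ≤ toℕ (iter π k i)) (upTo n)

isCycleMin? : ∀ {n} (π : Permutation′ n) (i : Fin n) → Dec (isCycleMin π i)
isCycleMin? {n} π i = all? (λ k → toℕ i ≤? toℕ (iter π k i)) (upTo n)

-- number of cycles of π (fixed points included) = number of cycle minima
numCycles : ∀ {n} → Permutation′ n → ℕ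
numCycles {n} π = length (filter (isCycleMin? π) (allFin n))

-- A partition of Fin n is encoded by the Boolean matrix of its
-- "same cell" equivalence relation.
Rel : ℕ → Set
Rel n = Vec (Vec Bool n) n

related : ∀ {n} → Rel n → Fin n → Fin n → Set
related R i j = lookup (lookup R i) j ≡ true

cellSize : ∀ {n} → Rel n → Fin n → ℕ
cellSize {n} R i = length (filter (λ j → T? (lookup (lookup R i) j)) (allFin n))

-- R is a partition of {1..n} all of whose cells have size m
-- (hence it has n/m cells): an element of X_{n/m}
IsUniformPartition : ∀ {n} → ℕ → Rel n → Set
IsUniformPartition {n} m R =
  (∀ i → related R i i) ×
  (∀ i j → related R i j → related R j i) ×
  (∀ i j k → related R i j → related R j k → related R i k) ×
  (∀ i → cellSize R i ≡ m)

Preserves : ∀ {n} → Permutation′ n → Rel n → Set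
Preserves π R = ∀ i j → lookup (lookup R (π ⟨$⟩ʳ i)) (π ⟨$⟩ʳ j) ≡ lookup (lookup R i) j

-- Call two cycles of π linked when some cell of the partition meets both; as π permutes the
-- cells, this is an equivalence relation. Let the leader of a cycle be the least cycle minimum
-- of its linkage class. The cell of a leader meets every cycle of its class, in distinct
-- points, so each class has at most m cycles and at most c(m-1)/m cycles are not leaders.
-- The partition can be recovered from which points lie in the cell of their leader, which
-- points are leaders, and the leader of each non-leading cycle: the cell of a leader s
-- consists of the points with leader s lying in the cell of their leader, and the cell of any
-- other point x is the translate, along the cycle of x, of the cell of its leader. So there
-- are at most 2ⁿ·2ⁿ·c^(c(m-1)/m) invariant partitions, which gives the bound with C = 2 for
-- m ≥ 2; for m = 1 only the discrete partition exists.

module Submission where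

open import Data.Bool using (Bool; true; false; T)
import Data.Bool as Bool
open import Data.Bool.Properties using (T?; ⇔→≡)
open import Data.Digit using (Bit; 0b; 1b; Expansion; fromDigits)
open import Data.Fin using (Fin; toℕ) renaming (_≟_ to _≟ᶠ_)
open import Data.Fin.Permutation using (Permutation′; _⟨$⟩ʳ_; _⟨$⟩ˡ_; inverseˡ)
open import Data.Fin.Properties using (toℕ<n; toℕ-injective; pigeonhole)
open import Data.List using (List; []; _∷_; length; map; filter; concatMap; allFin; upTo; applyUpTo; _++_)
open import Data.List.Membership.Propositional using (_∈_; find; lose)
open import Data.List.Membership.Propositional.Properties
  using ( ∈-∃++; ∈-++⁻; ∈-++⁺ˡ; ∈-++⁺ʳ; ∈-map⁺; ∈-map⁻; ∈-concatMap⁺; ∈-upTo⁺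
        ; ∈-applyUpTo⁺; ∈-applyUpTo⁻; ∈-filter⁺; ∈-filter⁻; ∈-allFin)
open import Data.List.Membership.Setoid.Properties using (index-injective)
open import Data.List.Properties
  using (length-map; length-++; length-++-sucʳ; length-upTo; length-tabulate; filter-≐; ∷-injective)
open import Data.List.Relation.Binary.Subset.Propositional using (_⊆_)
open import Data.List.Relation.Unary.All as All using (All; []; _∷_)
open import Data.List.Relation.Unary.All.Properties as All using (all-filter)
open import Data.List.Relation.Unary.AllPairs using ([]; _∷_)
open import Data.List.Relation.Unary.Any as Any using (Any; here; there; any?)
open import Data.List.Relation.Unary.Unique.Propositional using (Unique)
open import Data.List.Relation.Unary.Unique.Propositional.Properties as Unique
  using (Unique[x∷xs]⇒x∉xs; allFin⁺)
open import Data.Nat using (ℕ; zero; suc; _+_; _*_; _∸_; _^_; _≤_; _<_; z≤n; s≤s; NonZero; >-nonZero)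
open import Data.Nat.Divisibility using (_∣_)
open import Data.Nat.DivMod
  using (_%_; _/_; m*n/n≡m; /-monoˡ-≤; m/n*n≤m; [m+kn]%n≡m%n; m<n⇒m%n≡m; m%n<n; m≡m%n+[m/n]*n)
open import Data.Nat.Properties
open import Algebra.Properties.CommutativeSemigroup *-commutativeSemigroup using (interchange)
open import Data.List.Extrema ≤-totalOrder using (argmin; argmin-all; f[argmin]≤f[xs])
open import Data.Product using (Σ; ∃; _×_; _,_; proj₁; proj₂)
open import Data.Sum using (inj₁; inj₂)
open import Data.Vec using (lookup)
open import Data.Vec.Relation.Binary.Pointwise.Extensional using (ext; Pointwise-≡⇒≡)
open import Function.Base using (_∘_)
open import Function.Bundles using (mk⇔)
open import Relation.Binary.PropositionalEquality
  using (_≡_; refl; sym; trans; cong; cong₂; subst; _≗_; module ≡-Reasoning)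
import Relation.Binary.PropositionalEquality as ≡
open import Relation.Binary.Structures using (IsEquivalence)
open import Relation.Nullary using (Dec; yes; no; contradiction)
import Relation.Nullary.Decidable as Dec
open import Relation.Unary using (Decidable)
open import Relation.Unary.Properties using (∁?)

open import Defs

Unique-⊆⇒length≤ : ∀ {A : Set} {xs ys : List A} → Unique xs → xs ⊆ ys → length xs ≤ length ys
Unique-⊆⇒length≤ {xs = []} _ _ = z≤n
Unique-⊆⇒length≤ {xs = x ∷ xs} u@(_ ∷ xs-unique) xs⊆ys with ∈-∃++ (xs⊆ys (here refl))
... | as , bs , refl = begin
  suc (length xs)         ≤⟨ s≤s (Unique-⊆⇒length≤ xs-unique xs⊆as++bs) ⟩
  suc (length (as ++ bs)) ≡⟨ length-++-sucʳ as x bs ⟨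
  length (as ++ x ∷ bs)   ∎
  where
  open ≤-Reasoning
  xs⊆as++bs : xs ⊆ as ++ bs
  xs⊆as++bs {y} y∈xs with ∈-++⁻ as (xs⊆ys (there y∈xs))
  ... | inj₁ y∈as         = ∈-++⁺ˡ y∈as
  ... | inj₂ (here refl)  = contradiction y∈xs (Unique[x∷xs]⇒x∉xs u)
  ... | inj₂ (there y∈bs) = ∈-++⁺ʳ as y∈bs

Unique-map⁺-on : ∀ {A B : Set} {P : A → Set} (f : A → B) →
  (∀ {x y} → P x → P y → f x ≡ f y → x ≡ y) →
  ∀ {xs} → All P xs → Unique xs → Unique (map f xs)
Unique-map⁺-on f f-inj []         []            = []
Unique-map⁺-on f f-inj (px ∷ pxs) (x≢xs ∷ uxs) =
  All.map⁺ (All.zipWith (λ (x≢y , py) fx≡fy → x≢y (f-inj px py fx≡fy)) (x≢xs , pxs))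
  ∷ Unique-map⁺-on f f-inj pxs uxs

Unique-injectiveOn⇒length≤ : ∀ {A : Set} {P : A → Set} (f : A → ℕ) {N xs} →
  (∀ {x y} → P x → P y → f x ≡ f y → x ≡ y) → (∀ {x} → P x → f x < N) →
  All P xs → Unique xs → length xs ≤ N
Unique-injectiveOn⇒length≤ f {N} {xs} f-inj f<N pxs uxs = begin
  length xs         ≡⟨ length-map f xs ⟨
  length (map f xs) ≤⟨ Unique-⊆⇒length≤ (Unique-map⁺-on f f-inj pxs uxs) fxs⊆upTo ⟩
  length (upTo N)   ≡⟨ length-upTo N ⟩
  N                 ∎
  where
  open ≤-Reasoning
  fxs⊆upTo : map f xs ⊆ upTo N
  fxs⊆upTo y∈fxs with _ , x∈xs , refl ← ∈-map⁻ f y∈fxs = ∈-upTo⁺ (f<N (All.lookup pxs x∈xs))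

map≡map⇒≡ : ∀ {A B : Set} {f g : A → B} {xs x} → map f xs ≡ map g xs → x ∈ xs → f x ≡ g x
map≡map⇒≡ {xs = _ ∷ _} eq (here refl)  = proj₁ (∷-injective eq)
map≡map⇒≡ {xs = _ ∷ _} eq (there x∈xs) = map≡map⇒≡ (proj₂ (∷-injective eq)) x∈xs

length≡1⇒∈⇒≡ : ∀ {A : Set} {xs : List A} {x y} → length xs ≡ 1 → x ∈ xs → y ∈ xs → x ≡ y
length≡1⇒∈⇒≡ {xs = _ ∷ []} _ (here refl) (here refl) = refl

length-concatMap : ∀ {A B : Set} {m} (f : A → List B) → (∀ x → length (f x) ≡ m) →
  ∀ xs → length (concatMap f xs) ≡ length xs * m
length-concatMap f f-len []       = refl
length-concatMap f f-len (x ∷ xs) =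
  trans (length-++ (f x)) (cong₂ _+_ (f-len x) (length-concatMap f f-len xs))

length-filter+length-filter-∁ : ∀ {A : Set} {P : A → Set} (P? : Decidable P) xs →
  length (filter P? xs) + length (filter (∁? P?) xs) ≡ length xs
length-filter+length-filter-∁ P? []       = refl
length-filter+length-filter-∁ P? (x ∷ xs) with P? x
... | yes _ = cong suc (length-filter+length-filter-∁ P? xs)
... | no  _ = trans (+-suc _ _) (cong suc (length-filter+length-filter-∁ P? xs))

m+n*o<o*p : ∀ {m n o p} → m < o → n < p → m + n * o < o * p
m+n*o<o*p {m} {n} {o} {p} m<o n<p = begin-strict
  m + n * o   <⟨ +-monoˡ-< (n * o) m<o ⟩
  suc n * o   ≤⟨ *-monoˡ-≤ o n<p ⟩
  p * o       ≡⟨ *-comm p o ⟩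
  o * p       ∎
  where open ≤-Reasoning

m+n*o-injective : ∀ {m m′ n n′ o} → m < o → m′ < o → m + n * o ≡ m′ + n′ * o → m ≡ m′ × n ≡ n′
m+n*o-injective {m} {m′} {n} {n′} {o} m<o m′<o eq = m≡m′ , *-cancelʳ-≡ n n′ o (+-cancelˡ-≡ m _ _ eq′)
  where
  instance
    o≢0 : NonZero o
    o≢0 = >-nonZero (m<n⇒0<n m<o)
  m≡m′ : m ≡ m′
  m≡m′ = begin
    m                ≡⟨ m<n⇒m%n≡m m<o ⟨
    m % o            ≡⟨ [m+kn]%n≡m%n m n o ⟨
    (m + n * o) % o  ≡⟨ cong (_% o) eq ⟩
    (m′ + n′ * o) % o ≡⟨ [m+kn]%n≡m%n m′ n′ o ⟩
    m′ % o           ≡⟨ m<n⇒m%n≡m m′<o ⟩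
    m′               ∎
    where open ≡-Reasoning
  eq′ : m + n * o ≡ m + n′ * o
  eq′ = trans eq (cong (_+ n′ * o) (sym m≡m′))

m^n≤m^o : ∀ m {n o} → n ≤ o → (m ≡ 0 → o ≡ 0) → m ^ n ≤ m ^ o
m^n≤m^o zero    n≤o o≡0 with refl ← o≡0 refl with refl ← n≤0⇒n≡0 n≤o = ≤-refl
m^n≤m^o (suc m) n≤o _   = ^-monoʳ-≤ (suc m) n≤o

^-distribʳ-* : ∀ m n o → (m * n) ^ o ≡ m ^ o * n ^ o
^-distribʳ-* m n zero    = refl
^-distribʳ-* m n (suc o) = trans (cong (m * n *_) (^-distribʳ-* m n o)) (interchange m n (m ^ o) (n ^ o))

2^n*[2^n*c^k]^m≤ : ∀ {m} n c k → 2 ≤ m → k * m ≤ c * (m ∸ 1) →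
  (2 ^ n * (2 ^ n * c ^ k)) ^ m ≤ m ^ (2 * n * m) * c ^ (c * (m ∸ 1))
2^n*[2^n*c^k]^m≤ {m} n c k 2≤m k*m≤ = begin
  (2 ^ n * (2 ^ n * c ^ k)) ^ m    ≡⟨ cong (_^ m) (*-assoc (2 ^ n) (2 ^ n) (c ^ k)) ⟨
  (2 ^ n * 2 ^ n * c ^ k) ^ m      ≡⟨ ^-distribʳ-* (2 ^ n * 2 ^ n) (c ^ k) m ⟩
  (2 ^ n * 2 ^ n) ^ m * (c ^ k) ^ m ≤⟨ *-mono-≤ (^-monoˡ-≤ m 4ⁿ≤m²ⁿ) (≤-reflexive (^-*-assoc c k m)) ⟩
  (m ^ (2 * n)) ^ m * c ^ (k * m)   ≤⟨ *-mono-≤ (≤-reflexive (^-*-assoc m (2 * n) m)) (m^n≤m^o c k*m≤ λ { refl → refl }) ⟩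
  m ^ (2 * n * m) * c ^ (c * (m ∸ 1)) ∎
  where
  open ≤-Reasoning
  4ⁿ≤m²ⁿ : 2 ^ n * 2 ^ n ≤ m ^ (2 * n)
  4ⁿ≤m²ⁿ = begin
    2 ^ n * 2 ^ n ≡⟨ ^-distribˡ-+-* 2 n n ⟨
    2 ^ (n + n)   ≤⟨ ^-monoˡ-≤ (n + n) 2≤m ⟩
    m ^ (n + n)   ≡⟨ cong (λ k → m ^ (n + k)) (+-identityʳ n) ⟨
    m ^ (2 * n)   ∎

m+n≡o⇒o≤m*p⇒n*p≤o*[p∸1] : ∀ {m n o} p → m + n ≡ o → o ≤ m * p → n * p ≤ o * (p ∸ 1)
m+n≡o⇒o≤m*p⇒n*p≤o*[p∸1] {m} {n} {o} p m+n≡o o≤m*p = begin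
  n * p           ≤⟨ m+n≤o⇒m≤o∸n (n * p) n*p+o≤o*p ⟩
  o * p ∸ o       ≡⟨ cong (o * p ∸_) (*-identityʳ o) ⟨
  o * p ∸ o * 1   ≡⟨ *-distribˡ-∸ o p 1 ⟨
  o * (p ∸ 1)     ∎
  where
  open ≤-Reasoning
  n*p+o≤o*p : n * p + o ≤ o * p
  n*p+o≤o*p = begin
    n * p + o     ≤⟨ +-monoʳ-≤ (n * p) o≤m*p ⟩
    n * p + m * p ≡⟨ *-distribʳ-+ p n m ⟨
    (n + m) * p   ≡⟨ cong (_* p) (trans (+-comm n m) m+n≡o) ⟩
    o * p         ∎

fromDigits-< : ∀ {b} (ds : Expansion b) → fromDigits ds < b ^ length ds
fromDigits-< []       = s≤s z≤n
fromDigits-< (d ∷ ds) = m+n*o<o*p (toℕ<n d) (fromDigits-< ds)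

fromDigits-injective : ∀ {b} (ds es : Expansion b) → length ds ≡ length es →
  fromDigits ds ≡ fromDigits es → ds ≡ es
fromDigits-injective []       []       _   _  = refl
fromDigits-injective (d ∷ ds) (e ∷ es) len eq
  with d≡e , ds≡es ← m+n*o-injective (toℕ<n d) (toℕ<n e) eq =
  cong₂ _∷_ (toℕ-injective d≡e) (fromDigits-injective ds es (suc-injective len) ds≡es)

module Cycles {n : ℕ} (π : Permutation′ n) where

  iter-+ : ∀ a b x → iter π (a + b) x ≡ iter π a (iter π b x)
  iter-+ zero    b x = refl
  iter-+ (suc a) b x = cong (π ⟨$⟩ʳ_) (iter-+ a b x)

  iter-injective : ∀ k {x y} → iter π k x ≡ iter π k y → x ≡ y
  iter-injective zero    eq = eq
  iter-injective (suc k) eq = iter-injective k (trans (sym (inverseˡ π)) (trans (cong (π ⟨$⟩ˡ_) eq) (inverseˡ π)))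

  iter-period : ∀ x → ∃ λ p → suc p ≤ n × iter π (suc p) x ≡ x
  iter-period x with i , j , i<j , xᵢ≡xⱼ ← pigeonhole (n<1+n n) (λ k → iter π (toℕ k) x) =
    positive (m<n⇒0<n∸m i<j) (≤-trans (m∸n≤m (toℕ j) (toℕ i)) (≤-pred (toℕ<n j))) (iter-injective (toℕ i) xⱼ≡xᵢ)
    where
    xⱼ≡xᵢ : iter π (toℕ i) (iter π (toℕ j ∸ toℕ i) x) ≡ iter π (toℕ i) x
    xⱼ≡xᵢ = begin
      iter π (toℕ i) (iter π (toℕ j ∸ toℕ i) x) ≡⟨ iter-+ (toℕ i) (toℕ j ∸ toℕ i) x ⟨
      iter π (toℕ i + (toℕ j ∸ toℕ i)) x       ≡⟨ cong (λ k → iter π k x) (m+[n∸m]≡n (<⇒≤ i<j)) ⟩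
      iter π (toℕ j) x                         ≡⟨ xᵢ≡xⱼ ⟨
      iter π (toℕ i) x                         ∎
      where open ≡-Reasoning
    positive : ∀ {d} → 0 < d → d ≤ n → iter π d x ≡ x → ∃ λ p → suc p ≤ n × iter π (suc p) x ≡ x
    positive {suc p} _ p<n returns = p , p<n , returns

  iter-*-period : ∀ {p x} q → iter π p x ≡ x → iter π (q * p) x ≡ x
  iter-*-period         zero    _      = refl
  iter-*-period {p} {x} (suc q) returns = begin
    iter π (p + q * p) x        ≡⟨ iter-+ p (q * p) x ⟩
    iter π p (iter π (q * p) x) ≡⟨ cong (iter π p) (iter-*-period q returns) ⟩
    iter π p x                  ≡⟨ returns ⟩
    x                           ∎
    where open ≡-Reasoning

  iter-%-period : ∀ {p x} k → iter π (suc p) x ≡ x → iter π (k % suc p) x ≡ iter π k x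
  iter-%-period {p} {x} k returns = begin
    iter π r x                           ≡⟨ cong (iter π r) (iter-*-period (k / suc p) returns) ⟨
    iter π r (iter π (q * suc p) x)      ≡⟨ iter-+ r (q * suc p) x ⟨
    iter π (r + q * suc p) x             ≡⟨ cong (λ j → iter π j x) (m≡m%n+[m/n]*n k (suc p)) ⟨
    iter π k x                           ∎
    where
    open ≡-Reasoning
    r q : ℕ
    r = k % suc p
    q = k / suc p

  SameCycle : Fin n → Fin n → Set
  SameCycle x y = ∃ λ k → iter π k x ≡ y

  sameCycle-refl : ∀ {x} → SameCycle x x
  sameCycle-refl = 0 , refl

  sameCycle-trans : ∀ {x y z} → SameCycle x y → SameCycle y z → SameCycle x z
  sameCycle-trans {x} (a , refl) (b , refl) = b + a , iter-+ b a x

  sameCycle-sym : ∀ {x y} → SameCycle x y → SameCycle y x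
  sameCycle-sym {x} (k , refl) with p , _ , returns ← iter-period x = p * k , (begin
    iter π (p * k) (iter π k x) ≡⟨ iter-+ (p * k) k x ⟨
    iter π (p * k + k) x        ≡⟨ cong (λ j → iter π j x) (trans (+-comm (p * k) k) (*-comm (suc p) k)) ⟩
    iter π (k * suc p) x        ≡⟨ iter-*-period k returns ⟩
    x                           ∎)
    where open ≡-Reasoning

  orbit : Fin n → List (Fin n)
  orbit x = applyUpTo (λ k → iter π k x) n

  ∈-orbit⁻ : ∀ {x y} → y ∈ orbit x → SameCycle x y
  ∈-orbit⁻ y∈orbit with k , _ , refl ← ∈-applyUpTo⁻ _ y∈orbit = k , refl

  ∈-orbit⁺ : ∀ {x y} → SameCycle x y → y ∈ orbit x
  ∈-orbit⁺ {x} (k , refl) with p , p<n , returns ← iter-period x =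
    subst (_∈ orbit x) (iter-%-period k returns) (∈-applyUpTo⁺ _ (≤-trans (m%n<n k (suc p)) p<n))

  isCycleMin⇒≤ : ∀ {r y} → isCycleMin π r → SameCycle r y → toℕ r ≤ toℕ y
  isCycleMin⇒≤ r-min r⟳y with k , k<n , refl ← ∈-applyUpTo⁻ _ (∈-orbit⁺ r⟳y) = All.lookup r-min (∈-upTo⁺ k<n)

  ≤⇒isCycleMin : ∀ {r} → (∀ {y} → SameCycle r y → toℕ r ≤ toℕ y) → isCycleMin π r
  ≤⇒isCycleMin r≤ = All.tabulate (λ {k} _ → r≤ (k , refl))

  cycleMin : Fin n → Fin n
  cycleMin y = argmin toℕ y (orbit y)

  cycleMin-sameCycle : ∀ y → SameCycle y (cycleMin y)
  cycleMin-sameCycle y = argmin-all toℕ sameCycle-refl (All.tabulate ∈-orbit⁻)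

  cycleMin-≤ : ∀ {y z} → SameCycle y z → toℕ (cycleMin y) ≤ toℕ z
  cycleMin-≤ {y} y⟳z = All.lookup (f[argmin]≤f[xs] y (orbit y)) (∈-orbit⁺ y⟳z)

  cycleMin-isCycleMin : ∀ y → isCycleMin π (cycleMin y)
  cycleMin-isCycleMin y = ≤⇒isCycleMin λ m⟳z → cycleMin-≤ (sameCycle-trans (cycleMin-sameCycle y) m⟳z)

  cycleMin-unique : ∀ {r y} → isCycleMin π r → SameCycle r y → cycleMin y ≡ r
  cycleMin-unique {r} {y} r-min r⟳y = toℕ-injective (≤-antisym
    (cycleMin-≤ (sameCycle-sym r⟳y))
    (isCycleMin⇒≤ r-min (sameCycle-trans r⟳y (cycleMin-sameCycle y))))

  cycleMins : List (Fin n)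
  cycleMins = filter (isCycleMin? π) (allFin n)

  cycleMins-unique : Unique cycleMins
  cycleMins-unique = Unique.filter⁺ (isCycleMin? π) (allFin⁺ n)

  isCycleMin⇒∈ : ∀ {r} → isCycleMin π r → r ∈ cycleMins
  isCycleMin⇒∈ {r} = ∈-filter⁺ (isCycleMin? π) (∈-allFin r)

  ∈⇒isCycleMin : ∀ {r} → r ∈ cycleMins → isCycleMin π r
  ∈⇒isCycleMin r∈ = proj₂ (∈-filter⁻ (isCycleMin? π) {xs = allFin n} r∈)

  cycleMin∈cycleMins : ∀ y → cycleMin y ∈ cycleMins
  cycleMin∈cycleMins y = isCycleMin⇒∈ (cycleMin-isCycleMin y)

record IsInvariantEquivalence {n} (π : Permutation′ n) (R : Rel n) : Set where
  field
    isEquivalence : IsEquivalence (related R)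
    preserves     : Preserves π R

Rel-ext : ∀ {n} {R₁ R₂ : Rel n} → (∀ i j → lookup (lookup R₁ i) j ≡ lookup (lookup R₂ i) j) → R₁ ≡ R₂
Rel-ext entries≡ = Pointwise-≡⇒≡ (ext λ i → Pointwise-≡⇒≡ (ext (entries≡ i)))

uniform⇒invariantEquivalence : ∀ {n m} {π : Permutation′ n} {R : Rel n} →
  IsUniformPartition m R × Preserves π R → IsInvariantEquivalence π R
uniform⇒invariantEquivalence ((reflexive , symmetric , transitive , _) , preserves) = record
  { isEquivalence = record { refl = reflexive _ ; sym = symmetric _ _ ; trans = transitive _ _ _ }
  ; preserves     = preserves
  }

module Leaders {n : ℕ} (π : Permutation′ n) (R : Rel n) where

  open Cycles π

  entry : Fin n → Fin n → Bool
  entry x y = lookup (lookup R x) y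

  _∼_ : Fin n → Fin n → Set
  _∼_ = related R

  Linked : Fin n → Fin n → Set
  Linked s x = ∃ λ y → SameCycle x y × s ∼ y

  linked? : ∀ s x → Dec (Linked s x)
  linked? s x = Dec.map′ fromAny toAny (any? (λ y → entry s y Bool.≟ true) (orbit x))
    where
    fromAny : Any (s ∼_) (orbit x) → Linked s x
    fromAny s∼orbit with y , y∈orbit , s∼y ← find s∼orbit = y , ∈-orbit⁻ y∈orbit , s∼y
    toAny : Linked s x → Any (s ∼_) (orbit x)
    toAny (y , x⟳y , s∼y) = lose (∈-orbit⁺ x⟳y) s∼y

  -- cycleMin x is itself linked to x, so the default value of argmin is a genuine candidate.
  leader : Fin n → Fin n
  leader x = argmin toℕ (cycleMin x) (filter (λ s → linked? s x) cycleMins)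

  leader∈cycleMins : ∀ x → leader x ∈ cycleMins
  leader∈cycleMins x = argmin-all toℕ (cycleMin∈cycleMins x)
    (All.tabulate λ s∈ → proj₁ (∈-filter⁻ (λ s → linked? s x) s∈))

  isLeader? : ∀ x → Dec (leader x ≡ x)
  isLeader? x = leader x ≟ᶠ x

  leaders nonLeaders : List (Fin n)
  leaders    = filter isLeader? cycleMins
  nonLeaders = filter (∁? isLeader?) cycleMins

  mask : Fin n → Bool
  mask y = entry (leader y) y

  cell : Fin n → List (Fin n)
  cell s = filter (λ y → T? (entry s y)) (allFin n)

  module Properties (invariant : IsInvariantEquivalence π R) where

    open IsInvariantEquivalence invariant
    open IsEquivalence isEquivalence renaming (refl to ∼-refl; sym to ∼-sym; trans to ∼-trans)

    entry-iter : ∀ k x y → entry (iter π k x) (iter π k y) ≡ entry x y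
    entry-iter zero    x y = refl
    entry-iter (suc k) x y = trans (preserves _ _) (entry-iter k x y)

    ∼-iter : ∀ k {x y} → x ∼ y → iter π k x ∼ iter π k y
    ∼-iter k {x} {y} x∼y = trans (entry-iter k x y) x∼y

    entry-cong : ∀ {x y} → x ∼ y → ∀ z → entry x z ≡ entry y z
    entry-cong x∼y z = ⇔→≡ (mk⇔ (∼-trans (∼-sym x∼y)) (∼-trans x∼y))

    entry-shift : ∀ {s x} k → s ∼ iter π k x → ∀ z → entry x z ≡ entry s (iter π k z)
    entry-shift {s} {x} k s∼xₖ z = trans (sym (entry-iter k x z)) (entry-cong (∼-sym s∼xₖ) (iter π k z))

    linked-sym : ∀ {s x} → Linked s x → Linked x s
    linked-sym {s} (y , x⟳y , s∼y) with j , refl ← sameCycle-sym x⟳y = iter π j s , (j , refl) , ∼-sym (∼-iter j s∼y)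

    linked-trans : ∀ {a b c} → Linked a b → Linked b c → Linked a c
    linked-trans (y , (k , refl) , a∼y) (w , c⟳w , b∼w) =
      iter π k w , sameCycle-trans c⟳w (k , refl) , ∼-trans a∼y (∼-iter k b∼w)

    sameCycle⇒linked : ∀ {x y} → SameCycle x y → Linked x y
    sameCycle⇒linked {x} x⟳y = x , sameCycle-sym x⟳y , ∼-refl

    ∼⇒linked : ∀ {s y} → s ∼ y → Linked s y
    ∼⇒linked s∼y = _ , sameCycle-refl , s∼y

    leader-linked : ∀ x → Linked (leader x) x
    leader-linked x = argmin-all toℕ (sameCycle⇒linked (sameCycle-sym (cycleMin-sameCycle x)))
      (all-filter (λ s → linked? s x) cycleMins)

    leader-minimal : ∀ {s x} → s ∈ cycleMins → Linked s x → toℕ (leader x) ≤ toℕ s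
    leader-minimal {s} {x} s∈ s-x =
      All.lookup (f[argmin]≤f[xs] (cycleMin x) _) (∈-filter⁺ (λ t → linked? t x) s∈ s-x)

    leader-cong : ∀ {x y} → Linked x y → leader x ≡ leader y
    leader-cong {x} {y} x-y = toℕ-injective (≤-antisym
      (leader-minimal (leader∈cycleMins y) (linked-trans (leader-linked y) (linked-sym x-y)))
      (leader-minimal (leader∈cycleMins x) (linked-trans (leader-linked x) x-y)))

    leader-idempotent : ∀ x → leader (leader x) ≡ leader x
    leader-idempotent x = leader-cong (leader-linked x)

    leader-sameCycle : ∀ {x y} → SameCycle x y → leader x ≡ leader y
    leader-sameCycle x⟳y = leader-cong (sameCycle⇒linked x⟳y)

    leader-of-related : ∀ {s y} → leader s ≡ s → s ∼ y → leader y ≡ s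
    leader-of-related s-leads s∼y = trans (sym (leader-cong (∼⇒linked s∼y))) s-leads

    leader∈leaders : ∀ x → leader x ∈ leaders
    leader∈leaders x = ∈-filter⁺ isLeader? (leader∈cycleMins x) (leader-idempotent x)

    cycleMins⊆cellsOfLeaders : cycleMins ⊆ concatMap (map cycleMin ∘ cell) leaders
    cycleMins⊆cellsOfLeaders {r} r∈ with y , r⟳y , s∼y ← leader-linked r =
      ∈-concatMap⁺ (map cycleMin ∘ cell) (lose (leader∈leaders r)
        (subst (_∈ map cycleMin (cell (leader r))) (cycleMin-unique (∈⇒isCycleMin r∈) r⟳y)
          (∈-map⁺ cycleMin (∈-filter⁺ (λ z → T? (entry (leader r) z)) (∈-allFin y) (subst T (sym s∼y) _)))))

    numCycles≤leaders*m : ∀ {m} → (∀ s → cellSize R s ≡ m) → numCycles π ≤ length leaders * m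
    numCycles≤leaders*m cellSize≡m = ≤-trans (Unique-⊆⇒length≤ cycleMins-unique cycleMins⊆cellsOfLeaders)
      (≤-reflexive (length-concatMap _ (λ s → trans (length-map cycleMin (cell s)) (cellSize≡m s)) leaders))

    nonLeaders*m≤ : ∀ {m} → (∀ s → cellSize R s ≡ m) → length nonLeaders * m ≤ numCycles π * (m ∸ 1)
    nonLeaders*m≤ {m} cellSize≡m = m+n≡o⇒o≤m*p⇒n*p≤o*[p∸1] {length leaders} m
      (length-filter+length-filter-∁ isLeader? cycleMins) (numCycles≤leaders*m cellSize≡m)

module _ {n : ℕ} {π : Permutation′ n} where

  open Leaders π

  related-transfer : ∀ {R₁ R₂} → IsInvariantEquivalence π R₁ → leader R₁ ≗ leader R₂ → mask R₁ ≗ mask R₂ →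
    ∀ {s y} → leader R₁ s ≡ s → related R₁ s y → related R₂ s y
  related-transfer {R₁} {R₂} invariant₁ leader≗ mask≗ {s} {y} s-leads s∼y =
    subst (λ t → related R₂ t y) (trans (sym (leader≗ y)) leader₁y≡s)
      (trans (sym (mask≗ y)) (subst (λ t → related R₁ t y) (sym leader₁y≡s) s∼y))
    where
    leader₁y≡s : leader R₁ y ≡ s
    leader₁y≡s = Properties.leader-of-related R₁ invariant₁ s-leads s∼y

  leader≗∧mask≗⇒≡ : ∀ {R₁ R₂} → IsInvariantEquivalence π R₁ → IsInvariantEquivalence π R₂ →
    leader R₁ ≗ leader R₂ → mask R₁ ≗ mask R₂ → R₁ ≡ R₂
  leader≗∧mask≗⇒≡ {R₁} {R₂} invariant₁ invariant₂ leader≗ mask≗ = Rel-ext entry≡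
    where
    module P₁ = Properties R₁ invariant₁
    module P₂ = Properties R₂ invariant₂
    -- Both relations relate the leader s of x to the same point πᵏ x.
    entry≡ : ∀ x z → entry R₁ x z ≡ entry R₂ x z
    entry≡ x z with y , (k , refl) , s∼₁y ← P₁.leader-linked x = begin
      entry R₁ x z            ≡⟨ P₁.entry-shift k s∼₁y z ⟩
      entry R₁ s (iter π k z) ≡⟨ ⇔→≡ (mk⇔ (transfer₁₂ s-leads₁) (transfer₂₁ s-leads₂)) ⟩
      entry R₂ s (iter π k z) ≡⟨ P₂.entry-shift k (transfer₁₂ s-leads₁ s∼₁y) z ⟨
      entry R₂ x z            ∎
      where
      open ≡-Reasoning
      s : Fin n
      s = leader R₁ x
      s-leads₁ : leader R₁ s ≡ s
      s-leads₁ = P₁.leader-idempotent x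
      s-leads₂ : leader R₂ s ≡ s
      s-leads₂ = trans (sym (leader≗ s)) s-leads₁
      transfer₁₂ : ∀ {t y} → leader R₁ t ≡ t → related R₁ t y → related R₂ t y
      transfer₁₂ = related-transfer {R₁} {R₂} invariant₁ leader≗ mask≗
      transfer₂₁ : ∀ {t y} → leader R₂ t ≡ t → related R₂ t y → related R₁ t y
      transfer₂₁ = related-transfer {R₂} {R₁} invariant₂ (sym ∘ leader≗) (sym ∘ mask≗)

module Encoding {n : ℕ} (π : Permutation′ n) where

  open Cycles π
  open Leaders π

  toBit : Bool → Bit
  toBit false = 0b
  toBit true  = 1b

  toBit-injective : ∀ {a b} → toBit a ≡ toBit b → a ≡ b
  toBit-injective {false} {false} _ = refl
  toBit-injective {true}  {true}  _ = refl

  bits : (Fin n → Bool) → Expansion 2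
  bits f = map (toBit ∘ f) (allFin n)

  length-bits : ∀ f → length (bits f) ≡ n
  length-bits f = trans (length-map (toBit ∘ f) (allFin n)) (length-tabulate _)

  bits-< : ∀ f → fromDigits (bits f) < 2 ^ n
  bits-< f = subst (λ k → fromDigits (bits f) < 2 ^ k) (length-bits f) (fromDigits-< (bits f))

  bits-injective : ∀ {f g} → fromDigits (bits f) ≡ fromDigits (bits g) → f ≗ g
  bits-injective {f} {g} eq y = toBit-injective
    (map≡map⇒≡ (fromDigits-injective (bits f) (bits g) (trans (length-bits f) (sym (length-bits g))) eq) (∈-allFin y))

  isLeader : Rel n → Fin n → Bool
  isLeader R y = Dec.isYes (isLeader? R y)

  pointer : Rel n → Fin n → Fin (numCycles π)
  pointer R y = Any.index (leader∈cycleMins R y)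

  pointers : Rel n → Expansion (numCycles π)
  pointers R = map (pointer R) (nonLeaders R)

  encode : Rel n → ℕ
  encode R = fromDigits (bits (mask R)) + (fromDigits (bits (isLeader R)) + fromDigits (pointers R) * 2 ^ n) * 2 ^ n

  encode-< : ∀ {R k} → length (nonLeaders R) ≤ k → k ≤ numCycles π → encode R < 2 ^ n * (2 ^ n * numCycles π ^ k)
  encode-< {R} {k} nonLeaders≤k k≤c = m+n*o<o*p (bits-< (mask R)) (m+n*o<o*p (bits-< (isLeader R)) pointers<)
    where
    pointers< : fromDigits (pointers R) < numCycles π ^ k
    pointers< = <-≤-trans (fromDigits-< (pointers R))
      (m^n≤m^o (numCycles π) (≤-trans (≤-reflexive (length-map (pointer R) (nonLeaders R))) nonLeaders≤k)
        λ c≡0 → n≤0⇒n≡0 (subst (k ≤_) c≡0 k≤c))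

  isLeader≗⇒leads : ∀ {R₁ R₂} → isLeader R₁ ≗ isLeader R₂ → ∀ {r} → leader R₁ r ≡ r → leader R₂ r ≡ r
  isLeader≗⇒leads {R₁} {R₂} isLeader≗ {r} leads =
    Dec.toWitness {a? = isLeader? R₂ r} (subst T (isLeader≗ r) (Dec.fromWitness {a? = isLeader? R₁ r} leads))

  isLeader≗⇒nonLeaders≡ : ∀ {R₁ R₂} → isLeader R₁ ≗ isLeader R₂ → nonLeaders R₁ ≡ nonLeaders R₂
  isLeader≗⇒nonLeaders≡ {R₁} {R₂} isLeader≗ = filter-≐ (∁? (isLeader? R₁)) (∁? (isLeader? R₂))
    ( (λ ¬leads₁ leads₂ → ¬leads₁ (isLeader≗⇒leads {R₂} {R₁} (sym ∘ isLeader≗) leads₂))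
    , (λ ¬leads₂ leads₁ → ¬leads₂ (isLeader≗⇒leads {R₁} {R₂} isLeader≗ leads₁)))
    cycleMins

  leader≗-fromCode : ∀ {R₁ R₂} → IsInvariantEquivalence π R₁ → IsInvariantEquivalence π R₂ →
    isLeader R₁ ≗ isLeader R₂ → fromDigits (pointers R₁) ≡ fromDigits (pointers R₂) → leader R₁ ≗ leader R₂
  leader≗-fromCode {R₁} {R₂} invariant₁ invariant₂ isLeader≗ pointers-eq y = begin
    leader R₁ y            ≡⟨ Properties.leader-sameCycle R₁ invariant₁ (cycleMin-sameCycle y) ⟩
    leader R₁ (cycleMin y) ≡⟨ leader≗-on-cycleMins (cycleMin∈cycleMins y) ⟩
    leader R₂ (cycleMin y) ≡⟨ Properties.leader-sameCycle R₂ invariant₂ (cycleMin-sameCycle y) ⟨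
    leader R₂ y            ∎
    where
    open ≡-Reasoning
    nonLeaders≡ : nonLeaders R₁ ≡ nonLeaders R₂
    nonLeaders≡ = isLeader≗⇒nonLeaders≡ {R₁} {R₂} isLeader≗

    pointers≡ : map (pointer R₁) (nonLeaders R₁) ≡ map (pointer R₂) (nonLeaders R₁)
    pointers≡ = trans
      (fromDigits-injective (pointers R₁) (pointers R₂)
        (trans (length-map _ (nonLeaders R₁)) (trans (cong length nonLeaders≡) (sym (length-map _ (nonLeaders R₂)))))
        pointers-eq)
      (cong (map (pointer R₂)) (sym nonLeaders≡))

    leader≗-on-cycleMins : ∀ {r} → r ∈ cycleMins → leader R₁ r ≡ leader R₂ r
    leader≗-on-cycleMins {r} r∈ with isLeader? R₁ r
    ... | yes leads₁ = trans leads₁ (sym (isLeader≗⇒leads {R₁} {R₂} isLeader≗ leads₁))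
    ... | no ¬leads₁ = index-injective (≡.setoid _) (leader∈cycleMins R₁ r) (leader∈cycleMins R₂ r)
      (map≡map⇒≡ pointers≡ (∈-filter⁺ (∁? (isLeader? R₁)) r∈ ¬leads₁))

  encode-injective : ∀ {R₁ R₂} → IsInvariantEquivalence π R₁ → IsInvariantEquivalence π R₂ →
    encode R₁ ≡ encode R₂ → R₁ ≡ R₂
  encode-injective {R₁} {R₂} invariant₁ invariant₂ eq
    with masks≡ , rest≡ ← m+n*o-injective (bits-< (mask R₁)) (bits-< (mask R₂)) eq
    with isLeaders≡ , pointers≡ ← m+n*o-injective (bits-< (isLeader R₁)) (bits-< (isLeader R₂)) rest≡ =
    leader≗∧mask≗⇒≡ invariant₁ invariant₂
      (leader≗-fromCode invariant₁ invariant₂ (bits-injective isLeaders≡) pointers≡)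
      (bits-injective masks≡)

invariantUniformPartitions≤ : ∀ {n m} .{{_ : NonZero m}} (π : Permutation′ n) {ps : List (Rel n)} → Unique ps →
  All (λ R → IsUniformPartition m R × Preserves π R) ps →
  length ps ≤ 2 ^ n * (2 ^ n * numCycles π ^ (numCycles π * (m ∸ 1) / m))
invariantUniformPartitions≤ {n} {m} π unique partitions =
  Unique-injectiveOn⇒length≤ {P = λ R → IsUniformPartition m R × Preserves π R} encode
    (λ {R₁} {R₂} p₁ p₂ → encode-injective (uniform⇒invariantEquivalence {R = R₁} p₁) (uniform⇒invariantEquivalence {R = R₂} p₂))
    (λ {R} p → encode-< {R} (nonLeaders≤ {R} p) K≤c) partitions unique
  where
  open Encoding π
  open Leaders π using (nonLeaders; module Properties)
  c K : ℕ
  c = numCycles π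
  K = c * (m ∸ 1) / m

  nonLeaders≤ : ∀ {R} → IsUniformPartition m R × Preserves π R → length (nonLeaders R) ≤ K
  nonLeaders≤ {R} p@((_ , _ , _ , cellSize≡m) , _) = begin
    length (nonLeaders R)         ≡⟨ m*n/n≡m _ m ⟨
    length (nonLeaders R) * m / m ≤⟨ /-monoˡ-≤ m (Properties.nonLeaders*m≤ R (uniform⇒invariantEquivalence {R = R} p) cellSize≡m) ⟩
    K                             ∎
    where open ≤-Reasoning

  K≤c : K ≤ c
  K≤c = begin
    c * (m ∸ 1) / m ≤⟨ /-monoˡ-≤ m (*-monoʳ-≤ c (m∸n≤m m 1)) ⟩
    c * m / m       ≡⟨ m*n/n≡m c m ⟩
    c               ∎
    where open ≤-Reasoning

uniformPartition₁-unique : ∀ {n} {R₁ R₂ : Rel n} → IsUniformPartition 1 R₁ → IsUniformPartition 1 R₂ → R₁ ≡ R₂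
uniformPartition₁-unique {n} {R₁} {R₂} p₁ p₂ = Rel-ext λ i j → ⇔→≡ (mk⇔ (move {R₁} {R₂} p₁ p₂) (move {R₂} {R₁} p₂ p₁))
  where
  related⇒≡ : ∀ {R : Rel n} → IsUniformPartition 1 R → ∀ {i j} → related R i j → i ≡ j
  related⇒≡ {R} (reflexive , _ , _ , cellSize≡1) {i} {j} i∼j = length≡1⇒∈⇒≡ (cellSize≡1 i)
    (∈-filter⁺ (λ k → T? (lookup (lookup R i) k)) (∈-allFin i) (subst T (sym (reflexive i)) _))
    (∈-filter⁺ (λ k → T? (lookup (lookup R i) k)) (∈-allFin j) (subst T (sym i∼j) _))
  move : ∀ {R R′ : Rel n} → IsUniformPartition 1 R → IsUniformPartition 1 R′ → ∀ {i j} → related R i j → related R′ i j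
  move {R} {R′} p p′ {i} {j} i∼j with refl ← related⇒≡ {R} p {i} {j} i∼j = proj₁ p′ i

uniformPartitions₁-length≤1 : ∀ {n} {ps : List (Rel n)} → Unique ps → All (IsUniformPartition 1) ps → length ps ≤ 1
uniformPartitions₁-length≤1 unique partitions = Unique-injectiveOn⇒length≤ {P = IsUniformPartition 1} (λ _ → 0)
  (λ p₁ p₂ _ → uniformPartition₁-unique p₁ p₂) (λ _ → s≤s z≤n) partitions unique

invariantUniformPartitions^m≤ : ∀ {n m} → 2 ≤ m → (π : Permutation′ n) {ps : List (Rel n)} → Unique ps →
  All (λ R → IsUniformPartition m R × Preserves π R) ps →
  length ps ^ m ≤ m ^ (2 * n * m) * numCycles π ^ (numCycles π * (m ∸ 1))
invariantUniformPartitions^m≤ {n} {m@(suc _)} 2≤m π {ps} unique partitions = begin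
  length ps ^ m                                           ≤⟨ ^-monoˡ-≤ m (invariantUniformPartitions≤ π unique partitions) ⟩
  (2 ^ n * (2 ^ n * numCycles π ^ K)) ^ m                 ≤⟨ 2^n*[2^n*c^k]^m≤ n (numCycles π) K 2≤m (m/n*n≤m _ m) ⟩
  m ^ (2 * n * m) * numCycles π ^ (numCycles π * (m ∸ 1)) ∎
  where
  open ≤-Reasoning
  K : ℕ
  K = numCycles π * (m ∸ 1) / m

lemma4p4 : Σ ℕ λ C → (m n : ℕ) → 1 ≤ m → m ∣ n → (π : Permutation′ n)
    → (ps : List (Rel n)) → Unique ps
    → All (λ R → IsUniformPartition m R × Preserves π R) ps
    → length ps ^ m ≤ m ^ (C * n * m) * numCycles π ^ (numCycles π * (m ∸ 1))
lemma4p4 = 2 , λ where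
  1 n _ _ π ps unique partitions → let open ≤-Reasoning in begin
    length ps ^ 1 ≡⟨ ^-identityʳ (length ps) ⟩
    length ps     ≤⟨ uniformPartitions₁-length≤1 unique (All.map proj₁ partitions) ⟩
    1             ≡⟨ cong₂ _*_ (^-zeroˡ (2 * n * 1)) (cong (numCycles π ^_) (*-zeroʳ (numCycles π))) ⟨
    1 ^ (2 * n * 1) * numCycles π ^ (numCycles π * 0) ∎
  (suc (suc m)) n _ _ π ps unique partitions →
    invariantUniformPartitions^m≤ (s≤s (s≤s z≤n)) π unique partitions
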